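{- Let $u,v,\gamma$ be indeterminates and let $f(u,v,\gamma;z)=1+\sum_{n>0}f_n(u,v,\gamma)z^n$ be the unique formal power series solution of $$z^2f_{zz}+(1-\gamma)zf_z+\left(\frac{vz}{1-z}+\frac{uz}{(1-z)^2}\right)f=0,\qquad f(0)=1,$$ so that each $f_n$ is a rational function of $\gamma$ with coefficients polynomial in $u,v$. Then for every $n\ge1$, $$nP_n(u,v)=\operatorname{Res}(f_n;\gamma=n),$$ where $\operatorname{Res}(g;\gamma=\gamma_0)$ denotes the coefficient of $(\gamma-\gamma_0)^{ -1}$ in the Laurent expansion of $g$ about $\gamma_0$, and $$P_n(u,v)=\sum_{l=1}^n\sum_{k=0}^l S(k,l,n)u^kv^{l-k},\qquad S(k,l,n)=\sum_{\mathbf p}\frac{e_k(p_1,\ldots,p_l)}{L(\mathbf p)R(\mathbf p)},$$ the latter sum over all $l$-compositions $\mathbf p=(p_1,\ldots,p_l)$ of $n$, with $L(\mathbf p)=p_1(p_1+p_2)\cdots(p_1+\cdots+p_{l-1})\,n$ and $R(\mathbf p)=p_l(p_{l-1}+p_l)\cdots(p_2+\cdots+p_l)\,n$.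
   Context: An $l$-composition of $n$ is an ordered list of $l$ positive integers summing to $n$. $e_j(x_1,\ldots,x_k)$ is the $j$-th elementary symmetric function (coefficient of $X^{k-j}$ in $(X+x_1)\cdots(X+x_k)$), $e_0=1$. For $l=1$, $L(\mathbf p)=R(\mathbf p)=n$. -}

module Defs where

open import Data.Nat as ℕ using (ℕ; zero; suc; _∸_; _<ᵇ_)
open import Data.Integer as ℤ using (ℤ; +_; -[1+_])
open import Data.Rational as ℚ using (ℚ; 0ℚ; 1ℚ; _+_; _*_; -_; _-_; _/_)
open import Data.Bool using (if_then_else_)
open import Data.List as List using (List; []; _∷_; map; length; take; reverse; filter; concatMap; upTo)
open import Relation.Binary.PropositionalEquality using (_≡_)
open import Data.Nat using (_≟_)

ℕ→ℚ : ℕ → ℚ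
ℕ→ℚ n = + n / 1

_^ℚ_ : ℚ → ℕ → ℚ
q ^ℚ zero = 1ℚ
q ^ℚ suc k = q * (q ^ℚ k)

-- 1 / d for d > 0 (the value at d = 0 is never used below)
inv : ℕ → ℚ
inv zero = 0ℚ
inv (suc d) = + 1 / suc d

sumℚ : List ℚ → ℚ
sumℚ = List.foldr _+_ 0ℚ

Σ≤ : ℕ → (ℕ → ℚ) → ℚ
Σ≤ m g = sumℚ (map g (upTo (suc m)))

-- Laurent series in an indeterminate t over ℚ.
-- A value  laurent N a  represents  Σ_{i ≥ 0} a i · t^(i - N).

record Laurent : Set where
  constructor laurent
  field
    ord : ℕ
    cf  : ℕ → ℚ
open Laurent public

coeffL : Laurent → ℤ → ℚ
coeffL (laurent N a) k with k ℤ.+ + N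
... | + i = a i
... | -[1+ _ ] = 0ℚ

_≈L_ : Laurent → Laurent → Set
x ≈L y = ∀ k → coeffL x k ≡ coeffL y k

shiftUp : ℕ → (ℕ → ℚ) → ℕ → ℚ
shiftUp M a i = if i <ᵇ M then 0ℚ else a (i ∸ M)

_+L_ : Laurent → Laurent → Laurent
laurent N a +L laurent M b = laurent (N ℕ.+ M) (λ i → shiftUp M a i + shiftUp N b i)

_*L_ : Laurent → Laurent → Laurent
laurent N a *L laurent M b = laurent (N ℕ.+ M) (λ i → Σ≤ i (λ j → a j * b (i ∸ j)))

constL : ℚ → Laurent
constL q = laurent 0 (λ { zero → q ; (suc _) → 0ℚ })

0L 1L : Laurent
0L = constL 0ℚ
1L = constL 1ℚ

tL : Laurent
tL = laurent 0 (λ { (suc zero) → 1ℚ ; _ → 0ℚ })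

ΣL≤ : ℕ → (ℕ → Laurent) → Laurent
ΣL≤ m g = List.foldr _+L_ 0L (map g (upTo (suc m)))

FPS : Set → Set
FPS A = ℕ → A

∂z : FPS Laurent → FPS Laurent
∂z f m = constL (ℕ→ℚ (suc m)) *L f (suc m)

zmul : FPS Laurent → FPS Laurent
zmul f zero = 0L
zmul f (suc m) = f m

_+S_ : FPS Laurent → FPS Laurent → FPS Laurent
(f +S g) m = f m +L g m

_*S_ : FPS Laurent → FPS Laurent → FPS Laurent
(f *S g) m = ΣL≤ m (λ j → f j *L g (m ∸ j))

constS : Laurent → FPS Laurent
constS c zero = c
constS c (suc _) = 0L

-- 1/(1-z) = Σ z^k  and  1/(1-z)^2 = Σ (k+1) z^k, scaled by q
geom : ℚ → FPS Laurent
geom q k = constL q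

geom2 : ℚ → FPS Laurent
geom2 q k = constL (q * ℕ→ℚ (suc k))

-- The differential operator of the paper applied to f, with the
-- parameter γ an element g of the coefficient ring:
--   z² f_zz + (1-γ) z f_z + ( v z/(1-z) + u z/(1-z)² ) f
ODE-LHS : (u v : ℚ) (g : Laurent) → FPS Laurent → FPS Laurent
ODE-LHS u v g f =
  (zmul (zmul (∂z (∂z f))))
  +S ((constS (1L +L (constL (- 1ℚ) *L g)) *S zmul (∂z f))
  +S ((zmul (geom v) +S zmul (geom2 u)) *S f))

IsSolution : (u v : ℚ) (g : Laurent) → FPS Laurent → Set
IsSolution u v g f = (∀ m → ODE-LHS u v g f m ≈L 0L) × (f 0 ≈L 1L)
  where open import Data.Product using (_×_)

-- γ = n + t  (expansion about γ = n in the local variable t = γ - n)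
γ-at : ℕ → Laurent
γ-at n = constL (ℕ→ℚ n) +L tL

-- Res(g; γ = n) : coefficient of t^{-1} = (γ - n)^{-1}
Res : Laurent → ℚ
Res x = coeffL x -[1+ 0 ]

-- all compositions (lists of positive integers) summing to n;
-- the first argument is fuel (≥ n suffices)
compsAux : ℕ → ℕ → List (List ℕ)
compsAux _ zero = [] ∷ []
compsAux zero (suc n) = []
compsAux (suc f) (suc n) =
  concatMap (λ p → map (suc p ∷_) (compsAux f (n ∸ p))) (upTo (suc n))

compositions : ℕ → List (List ℕ)
compositions n = compsAux n n

compositionsOfLength : ℕ → ℕ → List (List ℕ)
compositionsOfLength l n = filter (λ p → length p ≟ l) (compositions n)

esym : ℕ → List ℚ → ℚ
esym zero _ = 1ℚ
esym (suc k) [] = 0ℚ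
esym (suc k) (x ∷ xs) = x * esym k xs + esym (suc k) xs

prefSums : List ℕ → List ℕ
prefSums [] = []
prefSums (x ∷ xs) = x ∷ map (x ℕ.+_) (prefSums xs)

prodℕ : List ℕ → ℕ
prodℕ = List.foldr ℕ._*_ 1

Lp : ℕ → List ℕ → ℕ
Lp n p = prodℕ (take (length p ∸ 1) (prefSums p)) ℕ.* n

Rp : ℕ → List ℕ → ℕ
Rp n p = prodℕ (take (length p ∸ 1) (prefSums (reverse p))) ℕ.* n

S : ℕ → ℕ → ℕ → ℚ
S k l n = sumℚ (map (λ p → esym k (map ℕ→ℚ p) * inv (Lp n p ℕ.* Rp n p))
                    (compositionsOfLength l n))

Σ1to : ℕ → (ℕ → ℚ) → ℚ
Σ1to n g = sumℚ (map (λ i → g (suc i)) (upTo n))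

P : ℕ → ℚ → ℚ → ℚ
P n u v = Σ1to n (λ l → Σ≤ l (λ k → S k l n * (u ^ℚ k) * (v ^ℚ (l ∸ k))))

-- Write γ = n + t. Comparing coefficients of z^m, the equation reads
--   m (m − n − t) f_m + Σ_{j=1}^{m} φ(j) f_{m−j} = 0,   φ(j) = v + u j.
-- For m < n the factor m (m − n) is a unit, so inductively f_m has no pole at t = 0 and its
-- constant terms a_m satisfy m (n − m) a_m = Σ_j φ(j) a_{m−j}, a_0 = 1, while at m = n the
-- coefficient of t⁻¹ gives n Res f_n = Σ_j φ(j) a_{n−j}. Unfolding this recursion along the first
-- part of a composition turns the right-hand side into Σ_p Π φ(p_i) / Π_{i<l} s_i (n − s_i) over the
-- compositions p of n, s_i = p_1 + ⋯ + p_i. As L(p) R(p) = n² Π_{i<l} s_i (n − s_i) and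
-- Σ_k e_k(p) u^k v^{l−k} = Π (v + u p_i), the same sum is n² P_n.

module Submission where

open import Defs
open import Data.Bool using (true; false; if_then_else_)
open import Data.Integer as ℤ using (ℤ; -[1+_]) renaming (+_ to pos)
import Data.Integer.Properties as ℤP
open import Data.List as List
  using (List; []; _∷_; _∷ʳ_; _++_; map; applyUpTo; upTo; concatMap; filter; length; take; reverse)
import Data.List.Properties as LP
open import Data.List.Relation.Binary.Permutation.Propositional.Properties using (↭-reverse)
open import Data.List.Relation.Unary.All as All using (All; []; _∷_; universal)
import Data.List.Relation.Unary.All.Properties as AllP
open import Data.Maybe.Base using (Maybe; just; nothing)
open import Data.Nat as ℕ using (ℕ; zero; suc; _≤_; _<_; z≤n; s≤s; _≟_)
open import Data.Nat.Induction using (<-rec)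
open import Data.Nat.ListAction using (sum)
open import Data.Nat.ListAction.Properties using (sum-↭; product-++)
import Data.Nat.Properties as ℕP
open import Data.Nat.Tactic.RingSolver using () renaming (ring to ℕ-ring)
open import Data.Product using (_×_; _,_; proj₁; proj₂)
open import Data.Rational as ℚ using (ℚ; 0ℚ; 1ℚ; _+_; _*_; -_; _-_)
import Data.Rational.Properties as ℚP
open import Data.Rational.Unnormalised as ℚᵘ using (mkℚᵘ; *≡*)
import Data.Rational.Unnormalised.Properties as ℚᵘP
open import Function using (_∘_)
open import Level using (0ℓ)
open import Relation.Binary.PropositionalEquality
open import Relation.Nullary using (yes; no; does)
open import Tactic.RingSolver using (solve-∀)
import Tactic.RingSolver.Core.AlmostCommutativeRing as ACR
open ≡-Reasoning

ℚ-ring : ACR.AlmostCommutativeRing 0ℓ 0ℓ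
ℚ-ring = ACR.fromCommutativeRing ℚP.+-*-commutativeRing isZero
  where
  isZero : (x : ℚ) → Maybe (0ℚ ≡ x)
  isZero x with 0ℚ ℚP.≟ x
  ... | yes p = just p
  ... | no _ = nothing

fromℚᵘ-+ : ∀ p q → ℚ.fromℚᵘ (p ℚᵘ.+ q) ≡ ℚ.fromℚᵘ p + ℚ.fromℚᵘ q
fromℚᵘ-+ p q = ℚP.toℚᵘ-injective (ℚᵘP.≃-trans (ℚP.toℚᵘ-fromℚᵘ (p ℚᵘ.+ q))
  (ℚᵘP.≃-sym (ℚᵘP.≃-trans (ℚP.toℚᵘ-homo-+ (ℚ.fromℚᵘ p) (ℚ.fromℚᵘ q))
    (ℚᵘP.+-cong (ℚP.toℚᵘ-fromℚᵘ p) (ℚP.toℚᵘ-fromℚᵘ q)))))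

fromℚᵘ-* : ∀ p q → ℚ.fromℚᵘ (p ℚᵘ.* q) ≡ ℚ.fromℚᵘ p * ℚ.fromℚᵘ q
fromℚᵘ-* p q = ℚP.toℚᵘ-injective (ℚᵘP.≃-trans (ℚP.toℚᵘ-fromℚᵘ (p ℚᵘ.* q))
  (ℚᵘP.≃-sym (ℚᵘP.≃-trans (ℚP.toℚᵘ-homo-* (ℚ.fromℚᵘ p) (ℚ.fromℚᵘ q))
    (ℚᵘP.*-cong (ℚP.toℚᵘ-fromℚᵘ p) (ℚP.toℚᵘ-fromℚᵘ q)))))

ℕ→ℚ-+ : ∀ m n → ℕ→ℚ (m ℕ.+ n) ≡ ℕ→ℚ m + ℕ→ℚ n
ℕ→ℚ-+ m n = trans (ℚP.fromℚᵘ-cong {mkℚᵘ (pos (m ℕ.+ n)) 0} {mkℚᵘ (pos m) 0 ℚᵘ.+ mkℚᵘ (pos n) 0} (*≡* numerators))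
                  (fromℚᵘ-+ (mkℚᵘ (pos m) 0) (mkℚᵘ (pos n) 0))
  where
  numerators : pos (m ℕ.+ n) ℤ.* pos 1 ≡ (pos m ℤ.* pos 1 ℤ.+ pos n ℤ.* pos 1) ℤ.* pos 1
  numerators = cong (ℤ._* pos 1) (sym (cong₂ ℤ._+_ (ℤP.*-identityʳ (pos m)) (ℤP.*-identityʳ (pos n))))

ℕ→ℚ-* : ∀ m n → ℕ→ℚ (m ℕ.* n) ≡ ℕ→ℚ m * ℕ→ℚ n
ℕ→ℚ-* m n = trans (ℚP.fromℚᵘ-cong {mkℚᵘ (pos (m ℕ.* n)) 0} {mkℚᵘ (pos m) 0 ℚᵘ.* mkℚᵘ (pos n) 0}
                                     (*≡* (cong (ℤ._* pos 1) (ℤP.pos-* m n))))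
                  (fromℚᵘ-* (mkℚᵘ (pos m) 0) (mkℚᵘ (pos n) 0))

inv-* : ∀ m n → inv (m ℕ.* n) ≡ inv m * inv n
inv-* zero n = sym (ℚP.*-zeroˡ (inv n))
inv-* (suc m) zero rewrite ℕP.*-zeroʳ m = sym (ℚP.*-zeroʳ (inv (suc m)))
inv-* (suc m) (suc n) =
  trans (ℚP.fromℚᵘ-cong {mkℚᵘ (pos 1) (n ℕ.+ m ℕ.* suc n)} {mkℚᵘ (pos 1) m ℚᵘ.* mkℚᵘ (pos 1) n} (*≡* refl))
        (fromℚᵘ-* (mkℚᵘ (pos 1) m) (mkℚᵘ (pos 1) n))

inv-inverseˡ : ∀ m .{{_ : ℕ.NonZero m}} → inv m * ℕ→ℚ m ≡ 1ℚ
inv-inverseˡ (suc m) = trans (sym (fromℚᵘ-* (mkℚᵘ (pos 1) m) (mkℚᵘ (pos (suc m)) 0)))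
                             (ℚP.fromℚᵘ-cong (ℚᵘP.*-inverseˡ (mkℚᵘ (pos (suc m)) 0)))

ℕ→ℚ-suc≢0 : ∀ m → ℕ→ℚ (suc m) ≢ 0ℚ
ℕ→ℚ-suc≢0 m eq = ℚP.1≢0 (begin
  1ℚ                          ≡⟨ sym (inv-inverseˡ (suc m)) ⟩
  inv (suc m) * ℕ→ℚ (suc m)   ≡⟨ cong (inv (suc m) *_) eq ⟩
  inv (suc m) * 0ℚ            ≡⟨ ℚP.*-zeroʳ (inv (suc m)) ⟩
  0ℚ                          ∎)

*-cancelˡ-≢0 : ∀ a {x y} → a ≢ 0ℚ → a * x ≡ a * y → x ≡ y
*-cancelˡ-≢0 a {x} {y} a≢0 eq = begin
  x                 ≡⟨ sym (ℚP.*-identityˡ x) ⟩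
  1ℚ * x            ≡⟨ cong (_* x) (sym (ℚP.*-inverseˡ a)) ⟩
  ℚ.1/ a * a * x    ≡⟨ ℚP.*-assoc (ℚ.1/ a) a x ⟩
  ℚ.1/ a * (a * x)  ≡⟨ cong (ℚ.1/ a *_) eq ⟩
  ℚ.1/ a * (a * y)  ≡⟨ sym (ℚP.*-assoc (ℚ.1/ a) a y) ⟩
  ℚ.1/ a * a * y    ≡⟨ cong (_* y) (ℚP.*-inverseˡ a) ⟩
  1ℚ * y            ≡⟨ ℚP.*-identityˡ y ⟩
  y                 ∎
  where instance _ = ℚ.≢-nonZero a≢0

[m]*[m-n]≢0 : ∀ {m n} → 0 < m → m < n → ℕ→ℚ m * (ℕ→ℚ m - ℕ→ℚ n) ≢ 0ℚ
[m]*[m-n]≢0 {suc m} {n} _ m<n eq = ℕ→ℚ-suc≢0 (d ℕ.+ m ℕ.* suc d) (ℚP.neg-injective (begin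
  - ℕ→ℚ (suc m ℕ.* suc d)                      ≡⟨ cong -_ (ℕ→ℚ-* (suc m) (suc d)) ⟩
  - (M * D)                                   ≡⟨ expand M D ⟩
  M * (M - (M + D))                           ≡⟨ cong (λ w → M * (M - w)) (sym (ℕ→ℚ-+ (suc m) (suc d))) ⟩
  M * (M - ℕ→ℚ (suc m ℕ.+ suc d))             ≡⟨ cong (λ w → M * (M - ℕ→ℚ w)) (trans (ℕP.+-suc (suc m) d) (ℕP.m+[n∸m]≡n m<n)) ⟩
  M * (M - ℕ→ℚ n)                             ≡⟨ eq ⟩
  - 0ℚ                                        ∎))
  where
  d = n ℕ.∸ suc (suc m)
  M = ℕ→ℚ (suc m)
  D = ℕ→ℚ (suc d)
  expand : ∀ M D → - (M * D) ≡ M * (M - (M + D))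
  expand = solve-∀ ℚ-ring

downward-induction : ∀ {P : ℕ → Set} N → (∀ i → N ≤ i → P i) → (∀ i → P (suc i) → P i) → ∀ i → P i
downward-induction {P} N base step i = go N i (ℕP.m≤m+n N i)
  where
  go : ∀ d i → N ≤ d ℕ.+ i → P i
  go zero i N≤i = base i N≤i
  go (suc d) i N≤d+i = step i (go d (suc i) (subst (N ≤_) (sym (ℕP.+-suc d i)) N≤d+i))

Σ< : ℕ → (ℕ → ℚ) → ℚ
Σ< zero g = 0ℚ
Σ< (suc n) g = g 0 + Σ< n (g ∘ suc)

Σ<-cong : ∀ n {f g : ℕ → ℚ} → (∀ i → i < n → f i ≡ g i) → Σ< n f ≡ Σ< n g
Σ<-cong zero eq = refl
Σ<-cong (suc n) eq = cong₂ _+_ (eq 0 (s≤s z≤n)) (Σ<-cong n (λ i i<n → eq (suc i) (s≤s i<n)))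

Σ<-zero : ∀ n {g : ℕ → ℚ} → (∀ i → g i ≡ 0ℚ) → Σ< n g ≡ 0ℚ
Σ<-zero zero eq = refl
Σ<-zero (suc n) eq = trans (cong₂ _+_ (eq 0) (Σ<-zero n (eq ∘ suc))) (ℚP.+-identityˡ 0ℚ)

Σ<-+ : ∀ n (f g : ℕ → ℚ) → Σ< n (λ i → f i + g i) ≡ Σ< n f + Σ< n g
Σ<-+ zero f g = sym (ℚP.+-identityˡ 0ℚ)
Σ<-+ (suc n) f g = trans (cong ((f 0 + g 0) +_) (Σ<-+ n (f ∘ suc) (g ∘ suc)))
                         (interchange (f 0) (g 0) (Σ< n (f ∘ suc)) (Σ< n (g ∘ suc)))
  where
  interchange : ∀ a b c d → (a + b) + (c + d) ≡ (a + c) + (b + d)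
  interchange = solve-∀ ℚ-ring

Σ<-*ˡ : ∀ n c (g : ℕ → ℚ) → Σ< n (λ i → c * g i) ≡ c * Σ< n g
Σ<-*ˡ zero c g = sym (ℚP.*-zeroʳ c)
Σ<-*ˡ (suc n) c g = trans (cong (c * g 0 +_) (Σ<-*ˡ n c (g ∘ suc)))
                          (sym (ℚP.*-distribˡ-+ c (g 0) (Σ< n (g ∘ suc))))

Σ<-snoc : ∀ n (g : ℕ → ℚ) → Σ< (suc n) g ≡ Σ< n g + g n
Σ<-snoc zero g = trans (ℚP.+-identityʳ (g 0)) (sym (ℚP.+-identityˡ (g 0)))
Σ<-snoc (suc n) g = trans (cong (g 0 +_) (Σ<-snoc n (g ∘ suc)))
                          (sym (ℚP.+-assoc (g 0) (Σ< n (g ∘ suc)) (g (suc n))))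

Σ<-indicator : ∀ n c (g : ℕ → ℚ) → c < n → Σ< n (λ i → if does (c ≟ i) then g i else 0ℚ) ≡ g c
Σ<-indicator (suc n) zero g _ = trans (cong (g 0 +_) (Σ<-zero n (λ _ → refl))) (ℚP.+-identityʳ (g 0))
Σ<-indicator (suc n) (suc c) g (s≤s c<n) =
  trans (cong (0ℚ +_) (Σ<-indicator n c (g ∘ suc) c<n)) (ℚP.+-identityˡ (g (suc c)))

sumℚ-applyUpTo : ∀ n (f : ℕ → ℕ) (g : ℕ → ℚ) → sumℚ (map g (applyUpTo f n)) ≡ Σ< n (g ∘ f)
sumℚ-applyUpTo zero f g = refl
sumℚ-applyUpTo (suc n) f g = cong (g (f 0) +_) (sumℚ-applyUpTo n (f ∘ suc) g)

Σ≤≡Σ< : ∀ m (g : ℕ → ℚ) → Σ≤ m g ≡ Σ< (suc m) g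
Σ≤≡Σ< m g = sumℚ-applyUpTo (suc m) (λ i → i) g

sumℚ-cong : ∀ {A : Set} {f g : A → ℚ} (xs : List A) → All (λ x → f x ≡ g x) xs →
            sumℚ (map f xs) ≡ sumℚ (map g xs)
sumℚ-cong [] [] = refl
sumℚ-cong (x ∷ xs) (eq ∷ eqs) = cong₂ _+_ eq (sumℚ-cong xs eqs)

sumℚ-*ˡ : ∀ {A : Set} c (g : A → ℚ) (xs : List A) → sumℚ (map (λ x → c * g x) xs) ≡ c * sumℚ (map g xs)
sumℚ-*ˡ c g [] = sym (ℚP.*-zeroʳ c)
sumℚ-*ˡ c g (x ∷ xs) = trans (cong (c * g x +_) (sumℚ-*ˡ c g xs))
                             (sym (ℚP.*-distribˡ-+ c (g x) (sumℚ (map g xs))))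

sumℚ-++ : ∀ {A : Set} (g : A → ℚ) (xs ys : List A) →
          sumℚ (map g (xs ++ ys)) ≡ sumℚ (map g xs) + sumℚ (map g ys)
sumℚ-++ g [] ys = sym (ℚP.+-identityˡ _)
sumℚ-++ g (x ∷ xs) ys = trans (cong (g x +_) (sumℚ-++ g xs ys)) (sym (ℚP.+-assoc (g x) _ _))

sumℚ-concatMap : ∀ {A B : Set} (g : B → ℚ) (h : A → List B) (xs : List A) →
                 sumℚ (map g (concatMap h xs)) ≡ sumℚ (map (λ x → sumℚ (map g (h x))) xs)
sumℚ-concatMap g h [] = refl
sumℚ-concatMap g h (x ∷ xs) =
  trans (sumℚ-++ g (h x) (concatMap h xs)) (cong (sumℚ (map g (h x)) +_) (sumℚ-concatMap g h xs))

Σ<-sumℚ-comm : ∀ {A : Set} n (g : ℕ → A → ℚ) (xs : List A) →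
               Σ< n (λ i → sumℚ (map (g i) xs)) ≡ sumℚ (map (λ x → Σ< n (λ i → g i x)) xs)
Σ<-sumℚ-comm n g [] = Σ<-zero n (λ _ → refl)
Σ<-sumℚ-comm n g (x ∷ xs) = trans (Σ<-+ n (λ i → g i x) (λ i → sumℚ (map (g i) xs)))
                                  (cong (Σ< n (λ i → g i x) +_) (Σ<-sumℚ-comm n g xs))

sum-by-key : ∀ {A : Set} n (key : A → ℕ) (g : ℕ → A → ℚ) (xs : List A) →
             All (λ x → 1 ≤ key x × key x ≤ n) xs →
             Σ< n (λ i → sumℚ (map (g (suc i)) (filter (λ x → key x ≟ suc i) xs)))
             ≡ sumℚ (map (λ x → g (key x) x) xs)
sum-by-key n key g [] [] = Σ<-zero n (λ _ → refl)
sum-by-key n key g (x ∷ xs) ((1≤k , k≤n) ∷ bounds) = begin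
  Σ< n (λ i → sumℚ (map (g (suc i)) (filter (λ y → key y ≟ suc i) (x ∷ xs))))
    ≡⟨ Σ<-cong n (λ i _ → filter-∷ (suc i)) ⟩
  Σ< n (λ i → (if does (key x ≟ suc i) then g (suc i) x else 0ℚ) + rest i)
    ≡⟨ Σ<-+ n _ rest ⟩
  Σ< n (λ i → if does (key x ≟ suc i) then g (suc i) x else 0ℚ) + Σ< n rest
    ≡⟨ cong₂ _+_ (indicator (key x) 1≤k k≤n) (sum-by-key n key g xs bounds) ⟩
  g (key x) x + sumℚ (map (λ y → g (key y) y) xs) ∎
  where
  rest : ℕ → ℚ
  rest i = sumℚ (map (g (suc i)) (filter (λ y → key y ≟ suc i) xs))

  filter-∷ : ∀ l → sumℚ (map (g l) (filter (λ y → key y ≟ l) (x ∷ xs)))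
                   ≡ (if does (key x ≟ l) then g l x else 0ℚ) + sumℚ (map (g l) (filter (λ y → key y ≟ l) xs))
  filter-∷ l with does (key x ≟ l)
  ... | true = refl
  ... | false = sym (ℚP.+-identityˡ _)

  indicator : ∀ k → 1 ≤ k → k ≤ n → Σ< n (λ i → if does (k ≟ suc i) then g (suc i) x else 0ℚ) ≡ g k x
  indicator (suc c) _ c<n = Σ<-indicator n c (λ i → g (suc i) x) c<n

coeffℤ : (ℕ → ℚ) → ℤ → ℚ
coeffℤ a (pos i) = a i
coeffℤ a -[1+ _ ] = 0ℚ

coeffℤ-cong : ∀ {a b : ℕ → ℚ} z → (∀ i → a i ≡ b i) → coeffℤ a z ≡ coeffℤ b z
coeffℤ-cong (pos i) eq = eq i
coeffℤ-cong -[1+ _ ] eq = refl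

coeffℤ-+ : ∀ (a b : ℕ → ℚ) z → coeffℤ (λ i → a i + b i) z ≡ coeffℤ a z + coeffℤ b z
coeffℤ-+ a b (pos i) = refl
coeffℤ-+ a b -[1+ _ ] = sym (ℚP.+-identityˡ 0ℚ)

coeffℤ-*ˡ : ∀ c (a : ℕ → ℚ) z → coeffℤ (λ i → c * a i) z ≡ c * coeffℤ a z
coeffℤ-*ˡ c a (pos i) = refl
coeffℤ-*ˡ c a -[1+ _ ] = sym (ℚP.*-zeroʳ c)

coeffL-laurent : ∀ N a k → coeffL (laurent N a) k ≡ coeffℤ a (k ℤ.+ pos N)
coeffL-laurent N a k with k ℤ.+ pos N
... | pos i = refl
... | -[1+ _ ] = refl

shift : (ℕ → ℚ) → ℕ → ℚ
shift a zero = 0ℚ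
shift a (suc i) = a i

coeffℤ-shift : ∀ a z → coeffℤ (shift a) (ℤ.suc z) ≡ coeffℤ a z
coeffℤ-shift a (pos i) = refl
coeffℤ-shift a -[1+ zero ] = refl
coeffℤ-shift a -[1+ suc j ] = refl

coeffℤ-shiftUp : ∀ M a z → coeffℤ (shiftUp M a) (z ℤ.+ pos M) ≡ coeffℤ a z
coeffℤ-shiftUp zero a z = cong (coeffℤ a) (ℤP.+-identityʳ z)
coeffℤ-shiftUp (suc M) a z = begin
  coeffℤ (shiftUp (suc M) a) (z ℤ.+ pos (suc M))   ≡⟨ coeffℤ-cong (z ℤ.+ pos (suc M)) shiftUp-suc ⟩
  coeffℤ (shift (shiftUp M a)) (z ℤ.+ pos (suc M)) ≡⟨ cong (coeffℤ (shift (shiftUp M a))) +-suc ⟩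
  coeffℤ (shift (shiftUp M a)) (ℤ.suc (z ℤ.+ pos M)) ≡⟨ coeffℤ-shift (shiftUp M a) (z ℤ.+ pos M) ⟩
  coeffℤ (shiftUp M a) (z ℤ.+ pos M)               ≡⟨ coeffℤ-shiftUp M a z ⟩
  coeffℤ a z                                       ∎
  where
  shiftUp-suc : ∀ i → shiftUp (suc M) a i ≡ shift (shiftUp M a) i
  shiftUp-suc zero = refl
  shiftUp-suc (suc i) = refl

  +-suc : z ℤ.+ pos (suc M) ≡ ℤ.suc (z ℤ.+ pos M)
  +-suc = trans (sym (ℤP.+-assoc z (pos 1) (pos M)))
                (trans (cong (λ w → w ℤ.+ pos M) (ℤP.+-comm z (pos 1))) (ℤP.+-assoc (pos 1) z (pos M)))

coeffL-+L : ∀ x y k → coeffL (x +L y) k ≡ coeffL x k + coeffL y k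
coeffL-+L (laurent N a) (laurent M b) k = begin
  coeffL (laurent N a +L laurent M b) k
    ≡⟨ coeffL-laurent (N ℕ.+ M) _ k ⟩
  coeffℤ (λ i → shiftUp M a i + shiftUp N b i) (k ℤ.+ pos (N ℕ.+ M))
    ≡⟨ coeffℤ-+ (shiftUp M a) (shiftUp N b) (k ℤ.+ pos (N ℕ.+ M)) ⟩
  coeffℤ (shiftUp M a) (k ℤ.+ pos (N ℕ.+ M)) + coeffℤ (shiftUp N b) (k ℤ.+ pos (N ℕ.+ M))
    ≡⟨ cong₂ _+_ (trans (cong (coeffℤ (shiftUp M a)) (reassoc N M)) (coeffℤ-shiftUp M a (k ℤ.+ pos N)))
                 (trans (cong (coeffℤ (shiftUp N b)) (trans (cong (λ w → k ℤ.+ pos w) (ℕP.+-comm N M)) (reassoc M N)))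
                        (coeffℤ-shiftUp N b (k ℤ.+ pos M))) ⟩
  coeffℤ a (k ℤ.+ pos N) + coeffℤ b (k ℤ.+ pos M)
    ≡⟨ sym (cong₂ _+_ (coeffL-laurent N a k) (coeffL-laurent M b k)) ⟩
  coeffL (laurent N a) k + coeffL (laurent M b) k ∎
  where
  reassoc : ∀ P Q → k ℤ.+ pos (P ℕ.+ Q) ≡ k ℤ.+ pos P ℤ.+ pos Q
  reassoc P Q = trans (cong (λ w → k ℤ.+ w) (ℤP.pos-+ P Q)) (sym (ℤP.+-assoc k (pos P) (pos Q)))

coeffL-0L : ∀ k → coeffL 0L k ≡ 0ℚ
coeffL-0L k = trans (coeffL-laurent 0 (cf 0L) k) (vanish (k ℤ.+ pos 0))
  where
  vanish : ∀ z → coeffℤ (cf 0L) z ≡ 0ℚ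
  vanish (pos zero) = refl
  vanish (pos (suc i)) = refl
  vanish -[1+ _ ] = refl

coeffL-ΣL≤ : ∀ m (g : ℕ → Laurent) k → coeffL (ΣL≤ m g) k ≡ Σ< (suc m) (λ j → coeffL (g j) k)
coeffL-ΣL≤ m g k = go (suc m) (λ j → j)
  where
  go : ∀ n (f : ℕ → ℕ) → coeffL (List.foldr _+L_ 0L (map g (applyUpTo f n))) k ≡ Σ< n (λ j → coeffL (g (f j)) k)
  go zero f = coeffL-0L k
  go (suc n) f = trans (coeffL-+L (g (f 0)) _ k) (cong (coeffL (g (f 0)) k +_) (go n (f ∘ suc)))

Σ≤-linear : ∀ (p b : ℕ → ℚ) → (∀ j → p (suc (suc j)) ≡ 0ℚ) → ∀ i →
            Σ≤ i (λ j → p j * b (i ℕ.∸ j)) ≡ p 0 * b i + p 1 * shift b i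
Σ≤-linear p b p≥2 zero = cong (p 0 * b 0 +_) (sym (ℚP.*-zeroʳ (p 1)))
Σ≤-linear p b p≥2 (suc i) = begin
  Σ≤ (suc i) (λ j → p j * b (suc i ℕ.∸ j))
    ≡⟨ Σ≤≡Σ< (suc i) (λ j → p j * b (suc i ℕ.∸ j)) ⟩
  p 0 * b (suc i) + (p 1 * b i + Σ< i (λ j → p (suc (suc j)) * b (i ℕ.∸ suc j)))
    ≡⟨ cong (λ w → p 0 * b (suc i) + (p 1 * b i + w)) higher-terms ⟩
  p 0 * b (suc i) + (p 1 * b i + 0ℚ)
    ≡⟨ cong (p 0 * b (suc i) +_) (ℚP.+-identityʳ (p 1 * b i)) ⟩
  p 0 * b (suc i) + p 1 * b i ∎
  where
  higher-terms : Σ< i (λ j → p (suc (suc j)) * b (i ℕ.∸ suc j)) ≡ 0ℚ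
  higher-terms = Σ<-zero i (λ j → trans (cong (_* b (i ℕ.∸ suc j)) (p≥2 j)) (ℚP.*-zeroˡ (b (i ℕ.∸ suc j))))

coeffL-linear-*L : ∀ (p : ℕ → ℚ) → (∀ j → p (suc (suc j)) ≡ 0ℚ) → ∀ y k →
                   coeffL (laurent 0 p *L y) k ≡ p 0 * coeffL y k + p 1 * coeffL y (ℤ.pred k)
coeffL-linear-*L p p≥2 (laurent M b) k = begin
  coeffL (laurent 0 p *L laurent M b) k
    ≡⟨ coeffL-laurent M _ k ⟩
  coeffℤ (λ i → Σ≤ i (λ j → p j * b (i ℕ.∸ j))) z
    ≡⟨ coeffℤ-cong z (Σ≤-linear p b p≥2) ⟩
  coeffℤ (λ i → p 0 * b i + p 1 * shift b i) z
    ≡⟨ coeffℤ-+ _ _ z ⟩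
  coeffℤ (λ i → p 0 * b i) z + coeffℤ (λ i → p 1 * shift b i) z
    ≡⟨ cong₂ _+_ (coeffℤ-*ˡ (p 0) b z) (coeffℤ-*ˡ (p 1) (shift b) z) ⟩
  p 0 * coeffℤ b z + p 1 * coeffℤ (shift b) z
    ≡⟨ cong (λ w → p 0 * coeffℤ b z + p 1 * w) shift-pred ⟩
  p 0 * coeffℤ b z + p 1 * coeffℤ b (ℤ.pred k ℤ.+ pos M)
    ≡⟨ sym (cong₂ (λ w w′ → p 0 * w + p 1 * w′) (coeffL-laurent M b k) (coeffL-laurent M b (ℤ.pred k))) ⟩
  p 0 * coeffL (laurent M b) k + p 1 * coeffL (laurent M b) (ℤ.pred k) ∎
  where
  z = k ℤ.+ pos M
  shift-pred : coeffℤ (shift b) z ≡ coeffℤ b (ℤ.pred k ℤ.+ pos M)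
  shift-pred = trans (cong (λ w → coeffℤ (shift b) (w ℤ.+ pos M)) (sym (ℤP.suc-pred k)))
                     (trans (cong (coeffℤ (shift b)) (ℤP.+-assoc (pos 1) (ℤ.pred k) (pos M)))
                            (coeffℤ-shift b (ℤ.pred k ℤ.+ pos M)))

coeffL-constant-*L : ∀ (p : ℕ → ℚ) → (∀ j → p (suc j) ≡ 0ℚ) → ∀ y k →
                     coeffL (laurent 0 p *L y) k ≡ p 0 * coeffL y k
coeffL-constant-*L p p≥1 y k = begin
  coeffL (laurent 0 p *L y) k                              ≡⟨ coeffL-linear-*L p (p≥1 ∘ suc) y k ⟩
  p 0 * coeffL y k + p 1 * coeffL y (ℤ.pred k)             ≡⟨ cong (λ w → p 0 * coeffL y k + w * coeffL y (ℤ.pred k)) (p≥1 0) ⟩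
  p 0 * coeffL y k + 0ℚ * coeffL y (ℤ.pred k)              ≡⟨ cong (p 0 * coeffL y k +_) (ℚP.*-zeroˡ (coeffL y (ℤ.pred k))) ⟩
  p 0 * coeffL y k + 0ℚ                                    ≡⟨ ℚP.+-identityʳ (p 0 * coeffL y k) ⟩
  p 0 * coeffL y k                                         ∎

coeffL-constL-*L : ∀ c y k → coeffL (constL c *L y) k ≡ c * coeffL y k
coeffL-constL-*L c = coeffL-constant-*L (cf (constL c)) (λ _ → refl)

coeffL-below-ord : ∀ x i → ord x ≤ i → coeffL x -[1+ i ] ≡ 0ℚ
coeffL-below-ord (laurent N a) i N≤i = trans (coeffL-laurent N a -[1+ i ]) (cong (coeffℤ a) negative)
  where
  negative : -[1+ i ] ℤ.+ pos N ≡ -[1+ i ℕ.∸ N ]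
  negative = trans (ℤP.⊖-< (s≤s N≤i)) (cong (λ w → ℤ.- (pos w)) (ℕP.+-∸-assoc 1 N≤i))

coeffL-constS-*S : ∀ c g m k → coeffL ((constS c *S g) m) k ≡ coeffL (c *L g m) k
coeffL-constS-*S c g m k = begin
  coeffL ((constS c *S g) m) k
    ≡⟨ coeffL-ΣL≤ m _ k ⟩
  coeffL (c *L g m) k + Σ< m (λ j → coeffL (0L *L g (m ℕ.∸ suc j)) k)
    ≡⟨ cong (coeffL (c *L g m) k +_) (Σ<-zero m λ j →
         trans (coeffL-constL-*L 0ℚ (g (m ℕ.∸ suc j)) k) (ℚP.*-zeroˡ (coeffL (g (m ℕ.∸ suc j)) k))) ⟩
  coeffL (c *L g m) k + 0ℚ
    ≡⟨ ℚP.+-identityʳ (coeffL (c *L g m) k) ⟩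
  coeffL (c *L g m) k ∎

coeffL-[1-γ]*L : ∀ n y k → coeffL ((1L +L (constL (- 1ℚ) *L γ-at n)) *L y) k
                           ≡ (1ℚ - ℕ→ℚ n) * coeffL y k + - 1ℚ * coeffL y (ℤ.pred k)
coeffL-[1-γ]*L n y k = begin
  coeffL (laurent 0 c *L y) k                    ≡⟨ coeffL-linear-*L c c≥2 y k ⟩
  c 0 * coeffL y k + c 1 * coeffL y (ℤ.pred k)   ≡⟨ cong₂ (λ a b → a * coeffL y k + b * coeffL y (ℤ.pred k)) c0 c1 ⟩
  (1ℚ - ℕ→ℚ n) * coeffL y k + - 1ℚ * coeffL y (ℤ.pred k) ∎
  where
  c : ℕ → ℚ
  c = cf (1L +L (constL (- 1ℚ) *L γ-at n))

  -γ-coeff : ∀ i → cf (constL (- 1ℚ) *L γ-at n) i ≡ - 1ℚ * cf (γ-at n) i + 0ℚ * shift (cf (γ-at n)) i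
  -γ-coeff = Σ≤-linear (cf (constL (- 1ℚ))) (cf (γ-at n)) (λ _ → refl)

  c0 : c 0 ≡ 1ℚ - ℕ→ℚ n
  c0 = trans (cong (1ℚ +_) (-γ-coeff 0)) (simplify (ℕ→ℚ n))
    where
    simplify : ∀ x → 1ℚ + (- 1ℚ * (x + 0ℚ) + 0ℚ * 0ℚ) ≡ 1ℚ - x
    simplify = solve-∀ ℚ-ring

  c1 : c 1 ≡ - 1ℚ
  c1 = trans (cong (0ℚ +_) (-γ-coeff 1)) (simplify (ℕ→ℚ n))
    where
    simplify : ∀ x → 0ℚ + (- 1ℚ * (0ℚ + 1ℚ) + 0ℚ * (x + 0ℚ)) ≡ - 1ℚ
    simplify = solve-∀ ℚ-ring

  c≥2 : ∀ j → c (suc (suc j)) ≡ 0ℚ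
  c≥2 j = trans (cong (0ℚ +_) (-γ-coeff (suc (suc j)))) (simplify (cf (γ-at n) (suc j)))
    where
    simplify : ∀ x → 0ℚ + (- 1ℚ * (0ℚ + 0ℚ) + 0ℚ * x) ≡ 0ℚ
    simplify = solve-∀ ℚ-ring

-- φ j is the coefficient of z^j (j ≥ 1) in vz/(1−z) + uz/(1−z)².
φ : ℚ → ℚ → ℕ → ℚ
φ u v j = v + u * ℕ→ℚ j

conv : ℚ → ℚ → (ℕ → ℚ) → ℕ → ℚ
conv u v a m = Σ< m (λ j → φ u v (suc j) * a (m ℕ.∸ suc j))

module ODE (u v : ℚ) (n : ℕ) (f : FPS Laurent) where

  F : ℕ → ℤ → ℚ
  F m k = coeffL (f m) k

  coeffL-z²f″ : ∀ m k → coeffL (zmul (zmul (∂z (∂z f))) m) k ≡ ℕ→ℚ m * (ℕ→ℚ m - 1ℚ) * F m k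
  coeffL-z²f″ zero k = trans (coeffL-0L k) (simplify (0ℚ - 1ℚ) (F 0 k))
    where
    simplify : ∀ x y → 0ℚ ≡ 0ℚ * x * y
    simplify = solve-∀ ℚ-ring
  coeffL-z²f″ (suc zero) k = trans (coeffL-0L k) (simplify (F 1 k))
    where
    simplify : ∀ y → 0ℚ ≡ 1ℚ * (1ℚ - 1ℚ) * y
    simplify = solve-∀ ℚ-ring
  coeffL-z²f″ (suc (suc m)) k = begin
    coeffL (constL (ℕ→ℚ (suc m)) *L (constL (ℕ→ℚ (2 ℕ.+ m)) *L f (2 ℕ.+ m))) k
      ≡⟨ coeffL-constL-*L (ℕ→ℚ (suc m)) _ k ⟩
    ℕ→ℚ (suc m) * coeffL (constL (ℕ→ℚ (2 ℕ.+ m)) *L f (2 ℕ.+ m)) k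
      ≡⟨ cong (ℕ→ℚ (suc m) *_) (coeffL-constL-*L (ℕ→ℚ (2 ℕ.+ m)) (f (2 ℕ.+ m)) k) ⟩
    ℕ→ℚ (suc m) * (ℕ→ℚ (2 ℕ.+ m) * F (2 ℕ.+ m) k)
      ≡⟨ cong (λ w → ℕ→ℚ (suc m) * (w * F (2 ℕ.+ m) k)) (ℕ→ℚ-+ 1 (suc m)) ⟩
    ℕ→ℚ (suc m) * ((1ℚ + ℕ→ℚ (suc m)) * F (2 ℕ.+ m) k)
      ≡⟨ simplify (ℕ→ℚ (suc m)) (F (2 ℕ.+ m) k) ⟩
    (1ℚ + ℕ→ℚ (suc m)) * ((1ℚ + ℕ→ℚ (suc m)) - 1ℚ) * F (2 ℕ.+ m) k
      ≡⟨ cong (λ w → w * (w - 1ℚ) * F (2 ℕ.+ m) k) (sym (ℕ→ℚ-+ 1 (suc m))) ⟩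
    ℕ→ℚ (2 ℕ.+ m) * (ℕ→ℚ (2 ℕ.+ m) - 1ℚ) * F (2 ℕ.+ m) k ∎
    where
    simplify : ∀ x y → x * ((1ℚ + x) * y) ≡ (1ℚ + x) * ((1ℚ + x) - 1ℚ) * y
    simplify = solve-∀ ℚ-ring

  coeffL-zf′ : ∀ m k → coeffL (zmul (∂z f) m) k ≡ ℕ→ℚ m * F m k
  coeffL-zf′ zero k = trans (coeffL-0L k) (sym (ℚP.*-zeroˡ (F 0 k)))
  coeffL-zf′ (suc m) k = coeffL-constL-*L (ℕ→ℚ (suc m)) (f (suc m)) k

  potential : FPS Laurent
  potential = zmul (geom v) +S zmul (geom2 u)

  coeffL-potential*f : ∀ m k → coeffL ((potential *S f) m) k ≡ conv u v (λ i → F i k) m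
  coeffL-potential*f m k = begin
    coeffL ((potential *S f) m) k
      ≡⟨ coeffL-ΣL≤ m _ k ⟩
    coeffL (potential 0 *L f m) k + Σ< m (λ j → coeffL (potential (suc j) *L f (m ℕ.∸ suc j)) k)
      ≡⟨ cong₂ _+_ (trans (constant 0 (f m)) (ℚP.*-zeroˡ (F m k))) (Σ<-cong m λ j _ → constant (suc j) (f (m ℕ.∸ suc j))) ⟩
    0ℚ + conv u v (λ i → F i k) m
      ≡⟨ ℚP.+-identityˡ (conv u v (λ i → F i k) m) ⟩
    conv u v (λ i → F i k) m ∎
    where
    constant : ∀ j y → coeffL (potential j *L y) k ≡ cf (potential j) 0 * coeffL y k
    constant zero y = coeffL-constant-*L (cf (potential 0)) (λ _ → ℚP.+-identityˡ 0ℚ) y k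
    constant (suc j) y = coeffL-constant-*L (cf (potential (suc j))) (λ _ → ℚP.+-identityˡ 0ℚ) y k

  coeffL-[1-γ]zf′ : ∀ m k → coeffL ((constS (1L +L (constL (- 1ℚ) *L γ-at n)) *S zmul (∂z f)) m) k
                           ≡ (1ℚ - ℕ→ℚ n) * (ℕ→ℚ m * F m k) + - 1ℚ * (ℕ→ℚ m * F m (ℤ.pred k))
  coeffL-[1-γ]zf′ m k = begin
    coeffL ((constS (1L +L (constL (- 1ℚ) *L γ-at n)) *S zmul (∂z f)) m) k
      ≡⟨ coeffL-constS-*S _ (zmul (∂z f)) m k ⟩
    coeffL ((1L +L (constL (- 1ℚ) *L γ-at n)) *L zmul (∂z f) m) k
      ≡⟨ coeffL-[1-γ]*L n (zmul (∂z f) m) k ⟩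
    (1ℚ - ℕ→ℚ n) * coeffL (zmul (∂z f) m) k + - 1ℚ * coeffL (zmul (∂z f) m) (ℤ.pred k)
      ≡⟨ cong₂ (λ a b → (1ℚ - ℕ→ℚ n) * a + - 1ℚ * b) (coeffL-zf′ m k) (coeffL-zf′ m (ℤ.pred k)) ⟩
    (1ℚ - ℕ→ℚ n) * (ℕ→ℚ m * F m k) + - 1ℚ * (ℕ→ℚ m * F m (ℤ.pred k)) ∎

  coeffL-ODE-LHS : ∀ m k → coeffL (ODE-LHS u v (γ-at n) f m) k ≡
              ℕ→ℚ m * (ℕ→ℚ m - ℕ→ℚ n) * F m k - ℕ→ℚ m * F m (ℤ.pred k) + conv u v (λ i → F i k) m
  coeffL-ODE-LHS m k = begin
    coeffL (ODE-LHS u v (γ-at n) f m) k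
      ≡⟨ coeffL-+L _ _ k ⟩
    coeffL (zmul (zmul (∂z (∂z f))) m) k + coeffL (((constS _ *S zmul (∂z f)) +S (potential *S f)) m) k
      ≡⟨ cong (coeffL (zmul (zmul (∂z (∂z f))) m) k +_) (coeffL-+L _ _ k) ⟩
    coeffL (zmul (zmul (∂z (∂z f))) m) k + (coeffL ((constS _ *S zmul (∂z f)) m) k + coeffL ((potential *S f) m) k)
      ≡⟨ cong₂ _+_ (coeffL-z²f″ m k) (cong₂ _+_ (coeffL-[1-γ]zf′ m k) (coeffL-potential*f m k)) ⟩
    M * (M - 1ℚ) * F m k + ((1ℚ - N) * (M * F m k) + - 1ℚ * (M * F m (ℤ.pred k)) + conv u v (λ i → F i k) m)
      ≡⟨ collect M N (F m k) (F m (ℤ.pred k)) (conv u v (λ i → F i k) m) ⟩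
    M * (M - N) * F m k - M * F m (ℤ.pred k) + conv u v (λ i → F i k) m ∎
    where
    M = ℕ→ℚ m
    N = ℕ→ℚ n
    collect : ∀ M N a b c →
      M * (M - 1ℚ) * a + ((1ℚ - N) * (M * a) + - 1ℚ * (M * b) + c) ≡ M * (M - N) * a - M * b + c
    collect = solve-∀ ℚ-ring

  module Solution (sol : IsSolution u v (γ-at n) f) where

    coeff-recurrence : ∀ m k →
      ℕ→ℚ m * (ℕ→ℚ m - ℕ→ℚ n) * F m k - ℕ→ℚ m * F m (ℤ.pred k) + conv u v (λ i → F i k) m ≡ 0ℚ
    coeff-recurrence m k = trans (sym (coeffL-ODE-LHS m k)) (trans (proj₁ sol m k) (coeffL-0L k))

    -- Below n the factor m (m − n) is invertible, so each coefficient of t^(−i) in f_m vanishes once the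
    -- one of t^(−i−1) does; below the order of f_m they all vanish.
    no-pole : ∀ m → m < n → ∀ i → F m -[1+ i ] ≡ 0ℚ
    no-pole = <-rec (λ m → m < n → ∀ i → F m -[1+ i ] ≡ 0ℚ) step
      where
      step : ∀ m → (∀ {j} → j < m → j < n → ∀ i → F j -[1+ i ] ≡ 0ℚ) → m < n → ∀ i → F m -[1+ i ] ≡ 0ℚ
      step zero _ _ i = proj₂ sol -[1+ i ]
      step (suc m) earlier m<n = downward-induction (ord (f (suc m))) (coeffL-below-ord (f (suc m))) lower
        where
        M = ℕ→ℚ (suc m)
        A = ℕ→ℚ (suc m) - ℕ→ℚ n

        lower : ∀ i → F (suc m) -[1+ suc i ] ≡ 0ℚ → F (suc m) -[1+ i ] ≡ 0ℚ
        lower i pole = *-cancelˡ-≢0 (M * A) ([m]*[m-n]≢0 (s≤s z≤n) m<n) (begin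
          M * A * F (suc m) -[1+ i ]
            ≡⟨ simplify (M * A * F (suc m) -[1+ i ]) M ⟩
          M * A * F (suc m) -[1+ i ] - M * 0ℚ + 0ℚ
            ≡⟨ cong₂ (λ a b → M * A * F (suc m) -[1+ i ] - M * a + b) (sym pole) (sym earlier-pole-free) ⟩
          M * A * F (suc m) -[1+ i ] - M * F (suc m) -[1+ suc i ] + conv u v (λ j → F j -[1+ i ]) (suc m)
            ≡⟨ coeff-recurrence (suc m) -[1+ i ] ⟩
          0ℚ
            ≡⟨ sym (ℚP.*-zeroʳ (M * A)) ⟩
          M * A * 0ℚ ∎)
          where
          simplify : ∀ a M → a ≡ a - M * 0ℚ + 0ℚ
          simplify = solve-∀ ℚ-ring
          m∸j<n : ∀ j → m ℕ.∸ j < n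
          m∸j<n j = ℕP.≤-<-trans (ℕP.m∸n≤m m j) (ℕP.<-trans (ℕP.n<1+n m) m<n)
          earlier-pole-free : conv u v (λ j → F j -[1+ i ]) (suc m) ≡ 0ℚ
          earlier-pole-free = Σ<-zero (suc m) λ j →
            trans (cong (φ u v (suc j) *_) (earlier (s≤s (ℕP.m∸n≤m m j)) (m∸j<n j) i)) (ℚP.*-zeroʳ (φ u v (suc j)))

    a : ℕ → ℚ
    a m = F m (pos 0)

    a₀≡1 : a 0 ≡ 1ℚ
    a₀≡1 = proj₂ sol (pos 0)

    a-recurrence : ∀ c m → .{{_ : ℕ.NonZero c}} → c ℕ.+ m ≡ n → conv u v a m ≡ ℕ→ℚ m * ℕ→ℚ c * a m
    a-recurrence c m c+m≡n = begin
      conv u v a m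
        ≡⟨ rearrange M C (a m) (conv u v a m) ⟩
      (M * (M - (C + M)) * a m - M * 0ℚ + conv u v a m) + M * C * a m
        ≡⟨ cong₂ (λ N r → (M * (M - N) * a m - M * r + conv u v a m) + M * C * a m) N≡C+M (no-pole m m<n 0) ⟨
      (M * (M - ℕ→ℚ n) * a m - M * F m -[1+ 0 ] + conv u v a m) + M * C * a m
        ≡⟨ cong (_+ M * C * a m) (coeff-recurrence m (pos 0)) ⟩
      0ℚ + M * C * a m
        ≡⟨ ℚP.+-identityˡ (M * C * a m) ⟩
      M * C * a m ∎
      where
      M = ℕ→ℚ m
      C = ℕ→ℚ c
      N≡C+M : ℕ→ℚ n ≡ C + M
      N≡C+M = trans (cong ℕ→ℚ (sym c+m≡n)) (ℕ→ℚ-+ c m)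
      m<n : m < n
      m<n = subst (m <_) c+m≡n (ℕP.m<n+m m (ℕ.>-nonZero⁻¹ c))
      rearrange : ∀ M C a x → x ≡ (M * (M - (C + M)) * a - M * 0ℚ + x) + M * C * a
      rearrange = solve-∀ ℚ-ring

    residue : ℕ→ℚ n * Res (f n) ≡ conv u v a n
    residue = begin
      N * Res (f n)
        ≡⟨ rearrange N (a n) (Res (f n)) (conv u v a n) ⟩
      conv u v a n - (N * (N - N) * a n - N * Res (f n) + conv u v a n)
        ≡⟨ cong (λ w → conv u v a n - w) (coeff-recurrence n (pos 0)) ⟩
      conv u v a n - 0ℚ
        ≡⟨ ℚP.+-identityʳ (conv u v a n) ⟩
      conv u v a n ∎
      where
      N = ℕ→ℚ n
      rearrange : ∀ N a r x → N * r ≡ x - (N * (N - N) * a - N * r + x)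
      rearrange = solve-∀ ℚ-ring

productℚ : List ℚ → ℚ
productℚ = List.foldr _*_ 1ℚ

esym-beyond-length : ∀ k (xs : List ℚ) → length xs < k → esym k xs ≡ 0ℚ
esym-beyond-length (suc k) [] _ = refl
esym-beyond-length (suc k) (x ∷ xs) (s≤s |xs|<k) = begin
  x * esym k xs + esym (suc k) xs
    ≡⟨ cong₂ (λ a b → x * a + b) (esym-beyond-length k xs |xs|<k) (esym-beyond-length (suc k) xs (ℕP.m<n⇒m<1+n |xs|<k)) ⟩
  x * 0ℚ + 0ℚ
    ≡⟨ trans (ℚP.+-identityʳ (x * 0ℚ)) (ℚP.*-zeroʳ x) ⟩
  0ℚ ∎

esym-generating : ∀ (u v : ℚ) (xs : List ℚ) →
  Σ< (suc (length xs)) (λ k → esym k xs * u ^ℚ k * v ^ℚ (length xs ℕ.∸ k)) ≡ productℚ (map (λ x → v + u * x) xs)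
esym-generating u v [] = refl
esym-generating u v (x ∷ ys) = begin
  1ℚ * 1ℚ * (v * v ^ℚ L) + Σ< (suc L) (λ k → (x * esym k ys + esym (suc k) ys) * (u * u ^ℚ k) * v ^ℚ (L ℕ.∸ k))
    ≡⟨ cong (1ℚ * 1ℚ * (v * v ^ℚ L) +_) (trans split (cong (x * u * G +_) drop-last)) ⟩
  1ℚ * 1ℚ * (v * v ^ℚ L) + (x * u * G + Σ< L B)
    ≡⟨ regroup v (x * u * G) (v ^ℚ L) (Σ< L B) ⟩
  x * u * G + (v * (1ℚ * 1ℚ * v ^ℚ L) + Σ< L B)
    ≡⟨ cong (x * u * G +_) v*G ⟨
  x * u * G + v * G
    ≡⟨ factor x u v G ⟩
  (v + u * x) * G
    ≡⟨ cong ((v + u * x) *_) (esym-generating u v ys) ⟩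
  (v + u * x) * productℚ (map (λ x → v + u * x) ys) ∎
  where
  L = length ys
  A : ℕ → ℚ
  A k = esym k ys * u ^ℚ k * v ^ℚ (L ℕ.∸ k)
  G = Σ< (suc L) A
  B : ℕ → ℚ
  B k = esym (suc k) ys * (u * u ^ℚ k) * v ^ℚ (L ℕ.∸ k)

  split : Σ< (suc L) (λ k → (x * esym k ys + esym (suc k) ys) * (u * u ^ℚ k) * v ^ℚ (L ℕ.∸ k)) ≡ x * u * G + Σ< (suc L) B
  split = begin
    Σ< (suc L) (λ k → (x * esym k ys + esym (suc k) ys) * (u * u ^ℚ k) * v ^ℚ (L ℕ.∸ k))
      ≡⟨ Σ<-cong (suc L) (λ k _ → distrib x u (esym k ys) (esym (suc k) ys) (u ^ℚ k) (v ^ℚ (L ℕ.∸ k))) ⟩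
    Σ< (suc L) (λ k → x * u * A k + B k)
      ≡⟨ Σ<-+ (suc L) (λ k → x * u * A k) B ⟩
    Σ< (suc L) (λ k → x * u * A k) + Σ< (suc L) B
      ≡⟨ cong (_+ Σ< (suc L) B) (Σ<-*ˡ (suc L) (x * u) A) ⟩
    x * u * G + Σ< (suc L) B ∎
    where
    distrib : ∀ x u e e′ U V → (x * e + e′) * (u * U) * V ≡ x * u * (e * U * V) + e′ * (u * U) * V
    distrib = solve-∀ ℚ-ring

  drop-last : Σ< (suc L) B ≡ Σ< L B
  drop-last = begin
    Σ< (suc L) B   ≡⟨ Σ<-snoc L B ⟩
    Σ< L B + B L   ≡⟨ cong (Σ< L B +_) last-vanishes ⟩
    Σ< L B + 0ℚ    ≡⟨ ℚP.+-identityʳ (Σ< L B) ⟩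
    Σ< L B         ∎
    where
    last-vanishes : B L ≡ 0ℚ
    last-vanishes = begin
      esym (suc L) ys * (u * u ^ℚ L) * v ^ℚ (L ℕ.∸ L)
        ≡⟨ cong (λ e → e * (u * u ^ℚ L) * v ^ℚ (L ℕ.∸ L)) (esym-beyond-length (suc L) ys ℕP.≤-refl) ⟩
      0ℚ * (u * u ^ℚ L) * v ^ℚ (L ℕ.∸ L)
        ≡⟨ cong (_* v ^ℚ (L ℕ.∸ L)) (ℚP.*-zeroˡ (u * u ^ℚ L)) ⟩
      0ℚ * v ^ℚ (L ℕ.∸ L)
        ≡⟨ ℚP.*-zeroˡ (v ^ℚ (L ℕ.∸ L)) ⟩
      0ℚ ∎

  v*G : v * G ≡ v * (1ℚ * 1ℚ * v ^ℚ L) + Σ< L B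
  v*G = trans (sym (Σ<-*ˡ (suc L) v A)) (cong (v * A 0 +_) (Σ<-cong L λ k k<L → begin
    v * (esym (suc k) ys * (u * u ^ℚ k) * v ^ℚ (L ℕ.∸ suc k))
      ≡⟨ commute v (esym (suc k) ys) (u * u ^ℚ k) (v ^ℚ (L ℕ.∸ suc k)) ⟩
    esym (suc k) ys * (u * u ^ℚ k) * v ^ℚ (suc (L ℕ.∸ suc k))
      ≡⟨ cong (λ e → esym (suc k) ys * (u * u ^ℚ k) * v ^ℚ e) (ℕP.+-∸-assoc 1 k<L) ⟨
    B k ∎))
    where
    commute : ∀ v E U W → v * (E * U * W) ≡ E * U * (v * W)
    commute = solve-∀ ℚ-ring

  regroup : ∀ v X W Y → 1ℚ * 1ℚ * (v * W) + (X + Y) ≡ X + (v * (1ℚ * 1ℚ * W) + Y)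
  regroup = solve-∀ ℚ-ring

  factor : ∀ x u v G → x * u * G + v * G ≡ (v + u * x) * G
  factor = solve-∀ ℚ-ring

compsAux-sound : ∀ fuel m → All (λ q → sum q ≡ m × length q ≤ m) (compsAux fuel m)
compsAux-sound fuel zero = (refl , z≤n) ∷ []
compsAux-sound zero (suc m) = []
compsAux-sound (suc fuel) (suc m) =
  AllP.concat⁺ (AllP.map⁺ (AllP.applyUpTo⁺₁ _ (suc m) λ {p} p<1+m →
    AllP.map⁺ (All.map (λ {q} → prepend {p} {q} (ℕP.≤-pred p<1+m)) (compsAux-sound fuel (m ℕ.∸ p)))))
  where
  prepend : ∀ {p q} → p ≤ m → sum q ≡ m ℕ.∸ p × length q ≤ m ℕ.∸ p →
            sum (suc p ∷ q) ≡ suc m × length (suc p ∷ q) ≤ suc m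
  prepend {p} p≤m (sum≡ , length≤) =
    cong suc (trans (cong (p ℕ.+_) sum≡) (ℕP.m+[n∸m]≡n p≤m)) ,
    s≤s (ℕP.≤-trans length≤ (ℕP.m∸n≤m m p))

prefSums-∷ʳ : ∀ ys z → prefSums (ys ∷ʳ z) ≡ prefSums ys ∷ʳ (sum ys ℕ.+ z)
prefSums-∷ʳ [] z = refl
prefSums-∷ʳ (y ∷ ys) z = cong (y ∷_) (begin
  map (y ℕ.+_) (prefSums (ys ∷ʳ z))                   ≡⟨ cong (map (y ℕ.+_)) (prefSums-∷ʳ ys z) ⟩
  map (y ℕ.+_) (prefSums ys ∷ʳ (sum ys ℕ.+ z))        ≡⟨ LP.map-++ (y ℕ.+_) (prefSums ys) _ ⟩
  map (y ℕ.+_) (prefSums ys) ∷ʳ (y ℕ.+ (sum ys ℕ.+ z)) ≡⟨ cong (map (y ℕ.+_) (prefSums ys) ∷ʳ_) (ℕP.+-assoc y (sum ys) z) ⟨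
  map (y ℕ.+_) (prefSums ys) ∷ʳ (y ℕ.+ sum ys ℕ.+ z)   ∎)

length-prefSums : ∀ ys → length (prefSums ys) ≡ length ys
length-prefSums [] = refl
length-prefSums (y ∷ ys) = cong suc (trans (LP.length-map (y ℕ.+_) (prefSums ys)) (length-prefSums ys))

take-length-++ : ∀ {A : Set} (xs ys : List A) → take (length xs) (xs ++ ys) ≡ xs
take-length-++ [] ys = refl
take-length-++ (x ∷ xs) ys = cong (x ∷_) (take-length-++ xs ys)

innerPrefixProduct : ℕ → List ℕ → ℕ
innerPrefixProduct c p = prodℕ (take (length p ℕ.∸ 1) (map (c ℕ.+_) (prefSums p)))

innerSuffixProduct : List ℕ → ℕ
innerSuffixProduct p = prodℕ (take (length p ℕ.∸ 1) (prefSums (reverse p)))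

innerPrefixProduct-∷∷ : ∀ c x y q → innerPrefixProduct c (x ∷ y ∷ q) ≡ (c ℕ.+ x) ℕ.* innerPrefixProduct (c ℕ.+ x) (y ∷ q)
innerPrefixProduct-∷∷ c x y q = cong (λ ss → (c ℕ.+ x) ℕ.* prodℕ (take (length q) ss)) (begin
  map (c ℕ.+_) (map (x ℕ.+_) (prefSums (y ∷ q)))   ≡⟨ LP.map-∘ (prefSums (y ∷ q)) ⟨
  map (λ s → c ℕ.+ (x ℕ.+ s)) (prefSums (y ∷ q))   ≡⟨ LP.map-cong (λ s → ℕP.+-assoc c x s) (prefSums (y ∷ q)) ⟨
  map ((c ℕ.+ x) ℕ.+_) (prefSums (y ∷ q))          ∎)

suffixProduct : List ℕ → ℕ
suffixProduct q = prodℕ (prefSums (reverse q))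

innerSuffixProduct-∷ : ∀ x q → innerSuffixProduct (x ∷ q) ≡ suffixProduct q
innerSuffixProduct-∷ x q = cong prodℕ (begin
  take (length q) (prefSums (reverse (x ∷ q)))
    ≡⟨ cong (λ r → take (length q) (prefSums r)) (LP.unfold-reverse x q) ⟩
  take (length q) (prefSums (reverse q ∷ʳ x))
    ≡⟨ cong (take (length q)) (prefSums-∷ʳ (reverse q) x) ⟩
  take (length q) (prefSums (reverse q) ∷ʳ (sum (reverse q) ℕ.+ x))
    ≡⟨ cong (λ l → take l (prefSums (reverse q) ∷ʳ (sum (reverse q) ℕ.+ x))) |q|≡ ⟩
  take (length (prefSums (reverse q))) (prefSums (reverse q) ∷ʳ (sum (reverse q) ℕ.+ x))
    ≡⟨ take-length-++ (prefSums (reverse q)) _ ⟩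
  prefSums (reverse q) ∎)
  where
  |q|≡ : length q ≡ length (prefSums (reverse q))
  |q|≡ = sym (trans (length-prefSums (reverse q)) (LP.length-reverse q))

suffixProduct-∷ : ∀ y q → suffixProduct (y ∷ q) ≡ suffixProduct q ℕ.* sum (y ∷ q)
suffixProduct-∷ y q = begin
  prodℕ (prefSums (reverse (y ∷ q)))                       ≡⟨ cong (prodℕ ∘ prefSums) (LP.unfold-reverse y q) ⟩
  prodℕ (prefSums (reverse q ∷ʳ y))                        ≡⟨ cong prodℕ (prefSums-∷ʳ (reverse q) y) ⟩
  prodℕ (prefSums (reverse q) ∷ʳ (sum (reverse q) ℕ.+ y))  ≡⟨ product-++ (prefSums (reverse q)) _ ⟩
  suffixProduct q ℕ.* ((sum (reverse q) ℕ.+ y) ℕ.* 1)      ≡⟨ cong (suffixProduct q ℕ.*_) (ℕP.*-identityʳ _) ⟩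
  suffixProduct q ℕ.* (sum (reverse q) ℕ.+ y)              ≡⟨ cong (λ s → suffixProduct q ℕ.* (s ℕ.+ y)) (sum-↭ (↭-reverse q)) ⟩
  suffixProduct q ℕ.* (sum q ℕ.+ y)                        ≡⟨ cong (suffixProduct q ℕ.*_) (ℕP.+-comm (sum q) y) ⟩
  suffixProduct q ℕ.* sum (y ∷ q)                          ∎

-- When c + sum p = n, cutProduct c p = Π_{i<l} sᵢ (n − sᵢ) with sᵢ = c + p₁ + ⋯ + pᵢ.
cutProduct : ℕ → List ℕ → ℕ
cutProduct c [] = 1
cutProduct c (x ∷ []) = 1
cutProduct c (x ∷ y ∷ q) = (c ℕ.+ x) ℕ.* sum (y ∷ q) ℕ.* cutProduct (c ℕ.+ x) (y ∷ q)

innerProducts≡cutProduct : ∀ c p → innerPrefixProduct c p ℕ.* innerSuffixProduct p ≡ cutProduct c p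
innerProducts≡cutProduct c [] = refl
innerProducts≡cutProduct c (x ∷ []) = refl
innerProducts≡cutProduct c (x ∷ y ∷ q) = begin
  innerPrefixProduct c (x ∷ y ∷ q) ℕ.* innerSuffixProduct (x ∷ y ∷ q)
    ≡⟨ cong₂ ℕ._*_ (innerPrefixProduct-∷∷ c x y q) suffix ⟩
  (c ℕ.+ x) ℕ.* innerPrefixProduct (c ℕ.+ x) (y ∷ q) ℕ.* (innerSuffixProduct (y ∷ q) ℕ.* sum (y ∷ q))
    ≡⟨ regroup (c ℕ.+ x) (innerPrefixProduct (c ℕ.+ x) (y ∷ q)) (innerSuffixProduct (y ∷ q)) (sum (y ∷ q)) ⟩
  (c ℕ.+ x) ℕ.* sum (y ∷ q) ℕ.* (innerPrefixProduct (c ℕ.+ x) (y ∷ q) ℕ.* innerSuffixProduct (y ∷ q))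
    ≡⟨ cong ((c ℕ.+ x) ℕ.* sum (y ∷ q) ℕ.*_) (innerProducts≡cutProduct (c ℕ.+ x) (y ∷ q)) ⟩
  (c ℕ.+ x) ℕ.* sum (y ∷ q) ℕ.* cutProduct (c ℕ.+ x) (y ∷ q) ∎
  where
  suffix : innerSuffixProduct (x ∷ y ∷ q) ≡ innerSuffixProduct (y ∷ q) ℕ.* sum (y ∷ q)
  suffix = begin
    innerSuffixProduct (x ∷ y ∷ q)            ≡⟨ innerSuffixProduct-∷ x (y ∷ q) ⟩
    suffixProduct (y ∷ q)                     ≡⟨ suffixProduct-∷ y q ⟩
    suffixProduct q ℕ.* sum (y ∷ q)           ≡⟨ cong (ℕ._* sum (y ∷ q)) (innerSuffixProduct-∷ y q) ⟨
    innerSuffixProduct (y ∷ q) ℕ.* sum (y ∷ q) ∎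

  regroup : ∀ a l r s → a ℕ.* l ℕ.* (r ℕ.* s) ≡ a ℕ.* s ℕ.* (l ℕ.* r)
  regroup = solve-∀ ℕ-ring

Lp*Rp≡n*n*cutProduct : ∀ n p → Lp n p ℕ.* Rp n p ≡ n ℕ.* n ℕ.* cutProduct 0 p
Lp*Rp≡n*n*cutProduct n p = begin
  Lp n p ℕ.* Rp n p
    ≡⟨ cong (λ ss → prodℕ (take (length p ℕ.∸ 1) ss) ℕ.* n ℕ.* Rp n p) (LP.map-id (prefSums p)) ⟨
  innerPrefixProduct 0 p ℕ.* n ℕ.* (innerSuffixProduct p ℕ.* n)
    ≡⟨ regroup (innerPrefixProduct 0 p) (innerSuffixProduct p) n ⟩
  n ℕ.* n ℕ.* (innerPrefixProduct 0 p ℕ.* innerSuffixProduct p)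
    ≡⟨ cong (n ℕ.* n ℕ.*_) (innerProducts≡cutProduct 0 p) ⟩
  n ℕ.* n ℕ.* cutProduct 0 p ∎
  where
  regroup : ∀ l r n → l ℕ.* n ℕ.* (r ℕ.* n) ≡ n ℕ.* n ℕ.* (l ℕ.* r)
  regroup = solve-∀ ℕ-ring

module Weights (u v : ℚ) where

  partProduct : List ℕ → ℚ
  partProduct p = productℚ (map (φ u v) p)

  weight : ℕ → List ℕ → ℚ
  weight c p = partProduct p * inv (cutProduct c p)

  weight-[_] : ∀ x c → weight c (x ∷ []) ≡ φ u v x
  weight-[ x ] c = trans (ℚP.*-identityʳ (φ u v x * 1ℚ)) (ℚP.*-identityʳ (φ u v x))

  weight-∷∷ : ∀ c x y q → weight c (x ∷ y ∷ q) ≡ φ u v x * inv ((c ℕ.+ x) ℕ.* sum (y ∷ q)) * weight (c ℕ.+ x) (y ∷ q)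
  weight-∷∷ c x y q = begin
    φ u v x * partProduct (y ∷ q) * inv ((c ℕ.+ x) ℕ.* sum (y ∷ q) ℕ.* cutProduct (c ℕ.+ x) (y ∷ q))
      ≡⟨ cong (φ u v x * partProduct (y ∷ q) *_) (inv-* ((c ℕ.+ x) ℕ.* sum (y ∷ q)) (cutProduct (c ℕ.+ x) (y ∷ q))) ⟩
    φ u v x * partProduct (y ∷ q) * (inv ((c ℕ.+ x) ℕ.* sum (y ∷ q)) * inv (cutProduct (c ℕ.+ x) (y ∷ q)))
      ≡⟨ regroup (φ u v x) (partProduct (y ∷ q)) (inv ((c ℕ.+ x) ℕ.* sum (y ∷ q))) (inv (cutProduct (c ℕ.+ x) (y ∷ q))) ⟩
    φ u v x * inv ((c ℕ.+ x) ℕ.* sum (y ∷ q)) * weight (c ℕ.+ x) (y ∷ q) ∎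
    where
    regroup : ∀ f P i j → f * P * (i * j) ≡ f * i * (P * j)
    regroup = solve-∀ ℚ-ring

  -- Splitting off the first part of a composition mirrors the recurrence of a: the factor 1/(c′ r)
  -- picked up by the weight (c′ the new offset, r the remaining sum) cancels the r (n − r) = r c′ of the recurrence.
  module _ (n : ℕ) (a : ℕ → ℚ) (a₀≡1 : a 0 ≡ 1ℚ)
           (a-recurrence : ∀ c m → .{{_ : ℕ.NonZero c}} → c ℕ.+ m ≡ n → conv u v a m ≡ ℕ→ℚ m * ℕ→ℚ c * a m) where

    Σweight-compsAux : ∀ fuel c s → s < fuel → c ℕ.+ suc s ≡ n →
                       sumℚ (map (weight c) (compsAux fuel (suc s))) ≡ conv u v a (suc s)
    Σweight-compsAux (suc fuel) c s (s≤s s≤fuel) c+1+s≡n = begin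
      sumℚ (map (weight c) (concatMap first-part (upTo (suc s))))
        ≡⟨ sumℚ-concatMap (weight c) first-part (upTo (suc s)) ⟩
      sumℚ (map (λ p → sumℚ (map (weight c) (first-part p))) (upTo (suc s)))
        ≡⟨ sumℚ-applyUpTo (suc s) (λ i → i) (λ p → sumℚ (map (weight c) (first-part p))) ⟩
      Σ< (suc s) (λ p → sumℚ (map (weight c) (first-part p)))
        ≡⟨ Σ<-cong (suc s) (λ p p<1+s → with-first-part p (ℕP.≤-pred p<1+s) (s ℕ.∸ p) refl) ⟩
      conv u v a (suc s) ∎
      where
      first-part : ℕ → List (List ℕ)
      first-part p = map (suc p ∷_) (compsAux fuel (s ℕ.∸ p))

      with-first-part : ∀ p → p ≤ s → ∀ r → s ℕ.∸ p ≡ r →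
                        sumℚ (map (weight c) (map (suc p ∷_) (compsAux fuel r))) ≡ φ u v (suc p) * a r
      with-first-part p _ zero _ = begin
        weight c (suc p ∷ []) + 0ℚ   ≡⟨ ℚP.+-identityʳ _ ⟩
        weight c (suc p ∷ [])        ≡⟨ weight-[ suc p ] c ⟩
        φ u v (suc p)                ≡⟨ ℚP.*-identityʳ (φ u v (suc p)) ⟨
        φ u v (suc p) * 1ℚ           ≡⟨ cong (φ u v (suc p) *_) a₀≡1 ⟨
        φ u v (suc p) * a 0          ∎
      with-first-part p p≤s (suc r) s∸p≡1+r = begin
        sumℚ (map (weight c) (map (suc p ∷_) (compsAux fuel (suc r))))
          ≡⟨ cong sumℚ (LP.map-∘ (compsAux fuel (suc r))) ⟨
        sumℚ (map (λ q → weight c (suc p ∷ q)) (compsAux fuel (suc r)))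
          ≡⟨ sumℚ-cong _ (All.map (λ {q} → peel q ∘ proj₁) (compsAux-sound fuel (suc r))) ⟩
        sumℚ (map (λ q → K * weight c′ q) (compsAux fuel (suc r)))
          ≡⟨ sumℚ-*ˡ K (weight c′) (compsAux fuel (suc r)) ⟩
        K * sumℚ (map (weight c′) (compsAux fuel (suc r)))
          ≡⟨ cong (K *_) (Σweight-compsAux fuel c′ r r<fuel c′+1+r≡n) ⟩
        K * conv u v a (suc r)
          ≡⟨ cong (K *_) (a-recurrence c′ (suc r) c′+1+r≡n) ⟩
        K * (R * C * a (suc r))
          ≡⟨ regroup (φ u v (suc p)) (inv (c′ ℕ.* suc r)) R C (a (suc r)) ⟩
        φ u v (suc p) * a (suc r) * (inv (c′ ℕ.* suc r) * (C * R))
          ≡⟨ cong (λ w → φ u v (suc p) * a (suc r) * (inv (c′ ℕ.* suc r) * w)) (ℕ→ℚ-* c′ (suc r)) ⟨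
        φ u v (suc p) * a (suc r) * (inv (c′ ℕ.* suc r) * ℕ→ℚ (c′ ℕ.* suc r))
          ≡⟨ cong (φ u v (suc p) * a (suc r) *_) (inv-inverseˡ (c′ ℕ.* suc r) {{ℕP.m*n≢0 c′ (suc r)}}) ⟩
        φ u v (suc p) * a (suc r) * 1ℚ
          ≡⟨ ℚP.*-identityʳ _ ⟩
        φ u v (suc p) * a (suc r) ∎
        where
        c′ = c ℕ.+ suc p
        instance
          c′≢0 : ℕ.NonZero c′
          c′≢0 = ℕ.>-nonZero (ℕP.<-≤-trans (s≤s z≤n) (ℕP.m≤n+m (suc p) c))
        K = φ u v (suc p) * inv (c′ ℕ.* suc r)
        R = ℕ→ℚ (suc r)
        C = ℕ→ℚ c′

        peel : ∀ q → sum q ≡ suc r → weight c (suc p ∷ q) ≡ K * weight c′ q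
        peel [] ()
        peel (y ∷ q) sum≡ = trans (weight-∷∷ c (suc p) y q)
                                  (cong (λ t → φ u v (suc p) * inv (c′ ℕ.* t) * weight c′ (y ∷ q)) sum≡)

        r<fuel : r < fuel
        r<fuel = ℕP.≤-trans (ℕP.≤-reflexive (sym s∸p≡1+r)) (ℕP.≤-trans (ℕP.m∸n≤m s p) s≤fuel)

        c′+1+r≡n : c′ ℕ.+ suc r ≡ n
        c′+1+r≡n = begin
          c ℕ.+ suc p ℕ.+ suc r       ≡⟨ cong (c ℕ.+ suc p ℕ.+_) s∸p≡1+r ⟨
          c ℕ.+ suc p ℕ.+ (s ℕ.∸ p)   ≡⟨ ℕP.+-assoc c (suc p) (s ℕ.∸ p) ⟩
          c ℕ.+ suc (p ℕ.+ (s ℕ.∸ p)) ≡⟨ cong (λ t → c ℕ.+ suc t) (ℕP.m+[n∸m]≡n p≤s) ⟩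
          c ℕ.+ suc s                 ≡⟨ c+1+s≡n ⟩
          n                           ∎

        regroup : ∀ f i R C a → f * i * (R * C * a) ≡ f * a * (i * (C * R))
        regroup = solve-∀ ℚ-ring

  P-as-Σ : ∀ n →
    P (suc n) u v ≡ sumℚ (map (λ p → inv (Lp (suc n) p ℕ.* Rp (suc n) p) * partProduct p) (compositions (suc n)))
  P-as-Σ n = begin
    P (suc n) u v
      ≡⟨ sumℚ-applyUpTo (suc n) (λ i → i) (λ i → Σ≤ (suc i) (λ k → S k (suc i) (suc n) * u ^ℚ k * v ^ℚ (suc i ℕ.∸ k))) ⟩
    Σ< (suc n) (λ i → Σ≤ (suc i) (λ k → S k (suc i) (suc n) * u ^ℚ k * v ^ℚ (suc i ℕ.∸ k)))
      ≡⟨ Σ<-cong (suc n) (λ i _ → by-length (suc i)) ⟩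
    Σ< (suc n) (λ i → sumℚ (map (H (suc i)) (filter (λ p → length p ≟ suc i) X)))
      ≡⟨ sum-by-key (suc n) length H X (All.map (λ {p} → bounds {p}) (compsAux-sound (suc n) (suc n))) ⟩
    sumℚ (map (λ p → H (length p) p) X)
      ≡⟨ sumℚ-cong X (universal (λ p → cong (w p *_) (generating p)) X) ⟩
    sumℚ (map (λ p → w p * partProduct p) X) ∎
    where
    X = compositions (suc n)
    w : List ℕ → ℚ
    w p = inv (Lp (suc n) p ℕ.* Rp (suc n) p)
    E : ℕ → List ℕ → ℚ
    E k p = esym k (map ℕ→ℚ p)
    H : ℕ → List ℕ → ℚ
    H l p = w p * Σ< (suc l) (λ k → E k p * u ^ℚ k * v ^ℚ (l ℕ.∸ k))

    by-length : ∀ l →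
      Σ≤ l (λ k → S k l (suc n) * u ^ℚ k * v ^ℚ (l ℕ.∸ k)) ≡ sumℚ (map (H l) (filter (λ p → length p ≟ l) X))
    by-length l = begin
      Σ≤ l (λ k → S k l (suc n) * U k * V k)
        ≡⟨ Σ≤≡Σ< l (λ k → S k l (suc n) * U k * V k) ⟩
      Σ< (suc l) (λ k → S k l (suc n) * U k * V k)
        ≡⟨ Σ<-cong (suc l) (λ k _ → scale k) ⟩
      Σ< (suc l) (λ k → sumℚ (map (λ p → w p * (E k p * U k * V k)) Y))
        ≡⟨ Σ<-sumℚ-comm (suc l) (λ k p → w p * (E k p * U k * V k)) Y ⟩
      sumℚ (map (λ p → Σ< (suc l) (λ k → w p * (E k p * U k * V k))) Y)
        ≡⟨ sumℚ-cong Y (universal (λ p → Σ<-*ˡ (suc l) (w p) (λ k → E k p * U k * V k)) Y) ⟩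
      sumℚ (map (H l) Y) ∎
      where
      Y = filter (λ p → length p ≟ l) X
      U V : ℕ → ℚ
      U k = u ^ℚ k
      V k = v ^ℚ (l ℕ.∸ k)
      scale : ∀ k → S k l (suc n) * U k * V k ≡ sumℚ (map (λ p → w p * (E k p * U k * V k)) Y)
      scale k = begin
        sumℚ (map (λ p → E k p * w p) Y) * U k * V k
          ≡⟨ ℚP.*-assoc (sumℚ (map (λ p → E k p * w p) Y)) (U k) (V k) ⟩
        sumℚ (map (λ p → E k p * w p) Y) * (U k * V k)
          ≡⟨ ℚP.*-comm (sumℚ (map (λ p → E k p * w p) Y)) (U k * V k) ⟩
        U k * V k * sumℚ (map (λ p → E k p * w p) Y)
          ≡⟨ sumℚ-*ˡ (U k * V k) (λ p → E k p * w p) Y ⟨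
        sumℚ (map (λ p → U k * V k * (E k p * w p)) Y)
          ≡⟨ sumℚ-cong Y (universal (λ p → commute (U k) (V k) (E k p) (w p)) Y) ⟩
        sumℚ (map (λ p → w p * (E k p * U k * V k)) Y) ∎
        where
        commute : ∀ U V e w → U * V * (e * w) ≡ w * (e * U * V)
        commute = solve-∀ ℚ-ring

    bounds : ∀ {p} → sum p ≡ suc n × length p ≤ suc n → 1 ≤ length p × length p ≤ suc n
    bounds {[]} (() , _)
    bounds {_ ∷ _} (_ , length≤) = s≤s z≤n , length≤

    generating : ∀ p → Σ< (suc (length p)) (λ k → E k p * u ^ℚ k * v ^ℚ (length p ℕ.∸ k)) ≡ partProduct p
    generating p = subst (λ l → Σ< (suc l) (λ k → E k p * u ^ℚ k * v ^ℚ (l ℕ.∸ k)) ≡ partProduct p)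
                         (LP.length-map ℕ→ℚ p)
                         (trans (esym-generating u v (map ℕ→ℚ p)) (cong productℚ (sym (LP.map-∘ p))))

  n²P≡Σweight : ∀ n →
    ℕ→ℚ (suc n) * (ℕ→ℚ (suc n) * P (suc n) u v) ≡ sumℚ (map (weight 0) (compositions (suc n)))
  n²P≡Σweight n = begin
    N * (N * P (suc n) u v)
      ≡⟨ cong (λ t → N * (N * t)) (P-as-Σ n) ⟩
    N * (N * sumℚ (map (λ p → w p * partProduct p) X))
      ≡⟨ trans (sumℚ-*ˡ N (λ p → N * (w p * partProduct p)) X)
               (cong (N *_) (sumℚ-*ˡ N (λ p → w p * partProduct p) X)) ⟨
    sumℚ (map (λ p → N * (N * (w p * partProduct p))) X)
      ≡⟨ sumℚ-cong X (universal normalise X) ⟩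
    sumℚ (map (weight 0) X) ∎
    where
    N = ℕ→ℚ (suc n)
    X = compositions (suc n)
    w : List ℕ → ℚ
    w p = inv (Lp (suc n) p ℕ.* Rp (suc n) p)

    normalise : ∀ p → N * (N * (w p * partProduct p)) ≡ weight 0 p
    normalise p = begin
      N * (N * (w p * partProduct p))
        ≡⟨ cong (λ t → N * (N * (inv t * partProduct p))) (Lp*Rp≡n*n*cutProduct (suc n) p) ⟩
      N * (N * (inv (suc n ℕ.* suc n ℕ.* cutProduct 0 p) * partProduct p))
        ≡⟨ cong (λ t → N * (N * (t * partProduct p))) (trans (inv-* (suc n ℕ.* suc n) (cutProduct 0 p))
                                                              (cong (_* inv (cutProduct 0 p)) (inv-* (suc n) (suc n)))) ⟩
      N * (N * (inv (suc n) * inv (suc n) * inv (cutProduct 0 p) * partProduct p))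
        ≡⟨ regroup N (inv (suc n)) (inv (cutProduct 0 p)) (partProduct p) ⟩
      (inv (suc n) * N) * ((inv (suc n) * N) * weight 0 p)
        ≡⟨ cong (λ t → t * (t * weight 0 p)) (inv-inverseˡ (suc n)) ⟩
      1ℚ * (1ℚ * weight 0 p)
        ≡⟨ ℚP.*-identityˡ (1ℚ * weight 0 p) ⟩
      1ℚ * weight 0 p
        ≡⟨ ℚP.*-identityˡ (weight 0 p) ⟩
      weight 0 p ∎
      where
      regroup : ∀ N i c P → N * (N * (i * i * c * P)) ≡ (i * N) * ((i * N) * (P * c))
      regroup = solve-∀ ℚ-ring

proposition1 : (n : ℕ) → 1 ≤ n → (u v : ℚ) → (f : FPS Laurent) →
    IsSolution u v (γ-at n) f →
    ℕ→ℚ n * P n u v ≡ Res (f n)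
proposition1 (suc n) _ u v f sol = *-cancelˡ-≢0 N (ℕ→ℚ-suc≢0 n) (begin
  N * (N * P (suc n) u v)                       ≡⟨ n²P≡Σweight n ⟩
  sumℚ (map (weight 0) (compositions (suc n)))  ≡⟨ Σweight-compsAux (suc n) a a₀≡1 a-recurrence (suc n) 0 n ℕP.≤-refl refl ⟩
  conv u v a (suc n)                            ≡⟨ residue ⟨
  N * Res (f (suc n))                           ∎)
  where
  N = ℕ→ℚ (suc n)
  open Weights u v
  open ODE.Solution u v (suc n) f sol
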